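{- Let $n\ge 2$ and let $H_n$ be the graph defined in the context. In every mutual-visibility coloring of $H_n$ that uses two colors, the vertices $c$ and $p$ receive different colors, the vertices $c'$ and $p'$ receive different colors, and among the vertices $p_1,\dots,p_n$ at least two receive different colors.
   Context: All graphs are finite, simple and connected. A set $S\subseteq V(G)$ is a mutual-visibility set if for every $x,y\in S$ there is a shortest $x$–$y$ path in $G$ none of whose internal vertices lies in $S$. A mutual-visibility coloring of $G$ is an assignment of colors to the vertices of $G$ in which every color class is a mutual-visibility set. For $n\ge 2$, $H_n$ is the graph obtained from two stars $K_{1,n+1}$ (each on $n+2$ vertices) by identifying $n$ leaves of the first star with $n$ leaves of the second star; the identified vertices are $p_1,\dots,p_n$, the center and the remaining (non-identified) leaf of the first star are $c$ and $p$, and those of the second star are $c'$ and $p'$. Thus $E(H_n)=\{cp,\,c'p'\}\cup\{cp_k,\,c'p_k : k\in[n]\}$. -}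

module Defs where

open import Data.Nat using (ℕ; zero; suc; _≤_)
open import Data.Fin using (Fin)
open import Data.Product using (Σ; ∃; _×_; _,_)
open import Relation.Nullary using (¬_)
open import Relation.Binary.PropositionalEquality using (_≡_)

data Walk {V : Set} (E : V → V → Set) : V → V → ℕ → Set where
  []  : ∀ {x} → Walk E x x 0
  _∷_ : ∀ {x y z k} → E x y → Walk E y z k → Walk E x z (suc k)

data InternalAll {V : Set} {E : V → V → Set} (P : V → Set)
     : ∀ {x z k} → Walk E x z k → Set where
  nil  : ∀ {x} → InternalAll P ([] {x = x})
  last : ∀ {x z} (e : E x z) → InternalAll P (e ∷ [])
  cons : ∀ {x y w z k} (e : E x y) (e' : E y w) (rest : Walk E w z k)
         → P y → InternalAll P (e' ∷ rest) → InternalAll P (e ∷ (e' ∷ rest))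

IsShortest : {V : Set} (E : V → V → Set) {x y : V} {k : ℕ} → Walk E x y k → Set
IsShortest E {x} {y} {k} _ = ∀ k' → Walk E x y k' → k ≤ k'

IsMutualVisibilitySet : {V : Set} (E : V → V → Set) (S : V → Set) → Set
IsMutualVisibilitySet {V} E S =
  ∀ x y → S x → S y →
  Σ ℕ λ k → Σ (Walk E x y k) λ w → IsShortest E w × InternalAll (λ v → ¬ S v) w

IsMVColoring : {V C : Set} (E : V → V → Set) (f : V → C) → Set
IsMVColoring E f = ∀ i → IsMutualVisibilitySet E (λ v → f v ≡ i)

data HV (n : ℕ) : Set where
  c p c' p' : HV n
  pk : Fin n → HV n

data HE (n : ℕ) : HV n → HV n → Set where
  c-p   : HE n c p
  p-c   : HE n p c
  c'-p' : HE n c' p'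
  p'-c' : HE n p' c'
  c-pk  : ∀ k → HE n c (pk k)
  pk-c  : ∀ k → HE n (pk k) c
  c'-pk : ∀ k → HE n c' (pk k)
  pk-c' : ∀ k → HE n (pk k) c'

{-# OPTIONS --safe #-}
-- If a pendant vertex u and its neighbour v share a colour, every other vertex
-- of that colour is hidden from u behind v; with two colours this forces all
-- remaining vertices into the other colour, and the second pendant pair
-- c'p' (resp. cp) then hides p₁ from p' (resp. p). Given that both pendant
-- pairs are bichromatic, each side {c, p} and {c', p'} contains a vertex of
-- any prescribed colour, and every walk between the sides passes through
-- some pₖ, so the pₖ cannot all have the same colour.
module Submission where

open import Defs
open import Data.Nat using (ℕ; zero; suc; _≤_)
open import Data.Fin using (Fin; zero; suc)
open import Data.Fin.Properties using (¬∀⟶∃¬; _≟_)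
open import Data.Product using (Σ; _×_; _,_)
open import Data.Sum using (_⊎_; inj₁; inj₂)
open import Data.Empty using (⊥; ⊥-elim)
open import Relation.Nullary using (¬_)
open import Relation.Binary.PropositionalEquality using (_≡_; _≢_; refl; sym; subst)

≢-fin2-cover : {x y : Fin 2} → x ≢ y → ∀ z → z ≡ x ⊎ z ≡ y
≢-fin2-cover {zero}     {zero}     x≢y _          = ⊥-elim (x≢y refl)
≢-fin2-cover {zero}     {suc zero} _   zero       = inj₁ refl
≢-fin2-cover {zero}     {suc zero} _   (suc zero) = inj₂ refl
≢-fin2-cover {suc zero} {zero}     _   zero       = inj₂ refl
≢-fin2-cover {suc zero} {zero}     _   (suc zero) = inj₁ refl
≢-fin2-cover {suc zero} {suc zero} x≢y _          = ⊥-elim (x≢y refl)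

≢-fin2-same : {x y z : Fin 2} → x ≢ z → y ≢ z → x ≡ y
≢-fin2-same {x} x≢z y≢z with ≢-fin2-cover y≢z x
... | inj₁ x≡y = x≡y
... | inj₂ x≡z = ⊥-elim (x≢z x≡z)

colour-attained : {V : Set} (f : V → Fin 2) {Side : V → Set} {u v : V} →
                  Side u → Side v → f u ≢ f v →
                  ∀ a → Σ V λ x → Side x × f x ≡ a
colour-attained f {u = u} {v} su sv fu≢fv a with ≢-fin2-cover fu≢fv a
... | inj₁ a≡fu = u , su , sym a≡fu
... | inj₂ a≡fv = v , sv , sym a≡fv

module _ {V : Set} {E : V → V → Set} where

  Pendant : V → V → Set
  Pendant u v = ∀ {y} → E u y → y ≡ v

  InternalAll-tail : ∀ {P : V → Set} {x y z k} {e : E x y} {w : Walk E y z k} →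
                     InternalAll P (e ∷ w) → InternalAll P w
  InternalAll-tail (last _)           = nil
  InternalAll-tail (cons _ _ _ _ all) = all

  pendant-walk-passes-neighbour : ∀ {P : V → Set} {u v y k} → Pendant u v →
                                  (w : Walk E u y k) → y ≢ u → y ≢ v →
                                  InternalAll P w → P v
  pendant-walk-passes-neighbour     pend []            y≢u _   _ = ⊥-elim (y≢u refl)
  pendant-walk-passes-neighbour     pend (e ∷ [])      _   y≢v _ = ⊥-elim (y≢v (pend e))
  pendant-walk-passes-neighbour {P} pend (e ∷ (_ ∷ _)) _   _   (cons _ _ _ Pnext _) =
    subst P (pend e) Pnext

  pendant-hides : ∀ {S : V → Set} {u v y} → IsMutualVisibilitySet E S →
                  Pendant u v → S u → S v → S y → y ≢ u → y ≢ v → ⊥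
  pendant-hides mv pend Su Sv Sy y≢u y≢v with mv _ _ Su Sy
  ... | _ , w , _ , internal = pendant-walk-passes-neighbour pend w y≢u y≢v internal Sv

  module _ {f : V → Fin 2} (mv : IsMVColoring E f) where

    monochromatic-pendant-isolates : ∀ {u v y} → Pendant u v → f u ≡ f v →
                                     y ≢ u → y ≢ v → f y ≢ f u
    monochromatic-pendant-isolates pend fu≡fv y≢u y≢v fy≡fu =
      pendant-hides (mv _) pend refl (sym fu≡fv) fy≡fu y≢u y≢v

    pendant-bichromatic : ∀ {u v u' v'} → Pendant u v → Pendant u' v' → (y : V) →
                          u' ≢ u → u' ≢ v → v' ≢ u → v' ≢ v → y ≢ u → y ≢ v →
                          y ≢ u' → y ≢ v' → f u ≢ f v
    pendant-bichromatic {u} {v} {u'} {v'} pend pend' y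
                        u'≢u u'≢v v'≢u v'≢v y≢u y≢v y≢u' y≢v' fu≡fv =
      pendant-hides (mv _) pend' refl (≢-fin2-same v'-other u'-other)
        (≢-fin2-same y-other u'-other) y≢u' y≢v'
      where
      u'-other : f u' ≢ f u
      u'-other = monochromatic-pendant-isolates pend fu≡fv u'≢u u'≢v
      v'-other : f v' ≢ f u
      v'-other = monochromatic-pendant-isolates pend fu≡fv v'≢u v'≢v
      y-other : f y ≢ f u
      y-other = monochromatic-pendant-isolates pend fu≡fv y≢u y≢v

module _ {n : ℕ} where

  p-pendant : Pendant {E = HE n} p c
  p-pendant p-c = refl

  p'-pendant : Pendant {E = HE n} p' c'
  p'-pendant p'-c' = refl

  data LeftSide : HV n → Set where
    c : LeftSide c
    p : LeftSide p

  data RightSide : HV n → Set where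
    c' : RightSide c'
    p' : RightSide p'

  crossing-walk-meets-middle : ∀ {P : HV n → Set} {x y k} → LeftSide x → RightSide y →
                               (w : Walk (HE n) x y k) → InternalAll P w →
                               Σ (Fin n) λ j → P (pk j)
  crossing-walk-meets-middle c ()  []                 _
  crossing-walk-meets-middle p ()  []                 _
  crossing-walk-meets-middle c r   (c-p ∷ w)          internal =
    crossing-walk-meets-middle p r w (InternalAll-tail internal)
  crossing-walk-meets-middle p r   (p-c ∷ w)          internal =
    crossing-walk-meets-middle c r w (InternalAll-tail internal)
  crossing-walk-meets-middle c ()  (c-pk j ∷ [])      _
  crossing-walk-meets-middle c _   (c-pk j ∷ (_ ∷ _)) (cons _ _ _ Pj _) = j , Pj

  middle-not-monochromatic : {f : HV n → Fin 2} → IsMVColoring (HE n) f →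
                             f c ≢ f p → f c' ≢ f p' → ∀ a → ¬ (∀ j → f (pk j) ≡ a)
  middle-not-monochromatic {f} mv fc≢fp fc'≢fp' a all-a
    with colour-attained f c p fc≢fp a | colour-attained f c' p' fc'≢fp' a
  ... | x , left , fx≡a | y , right , fy≡a with mv a x y fx≡a fy≡a
  ... | _ , w , _ , internal with crossing-walk-meets-middle left right w internal
  ... | j , fj≢a = fj≢a (all-a j)

mainTheorem1 : (n : ℕ) → 2 ≤ n → (f : HV n → Fin 2) → IsMVColoring (HE n) f
    → (∀ (i : Fin 2) → Σ (HV n) λ v → f v ≡ i)
    → (¬ f c ≡ f p) × (¬ f c' ≡ f p')
      × Σ (Fin n) λ i → Σ (Fin n) λ j → ¬ f (pk i) ≡ f (pk j)
mainTheorem1 zero () _ _ _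
mainTheorem1 (suc n) _ f mv _ = fc≢fp , fc'≢fp' , middle-bichromatic
  where
  fc≢fp : f c ≢ f p
  fc≢fp fc≡fp = pendant-bichromatic mv p-pendant p'-pendant (pk zero)
    (λ ()) (λ ()) (λ ()) (λ ()) (λ ()) (λ ()) (λ ()) (λ ()) (sym fc≡fp)
  fc'≢fp' : f c' ≢ f p'
  fc'≢fp' fc'≡fp' = pendant-bichromatic mv p'-pendant p-pendant (pk zero)
    (λ ()) (λ ()) (λ ()) (λ ()) (λ ()) (λ ()) (λ ()) (λ ()) (sym fc'≡fp')
  middle-bichromatic : Σ (Fin (suc n)) λ i → Σ (Fin (suc n)) λ j → f (pk i) ≢ f (pk j)
  middle-bichromatic
    with ¬∀⟶∃¬ (suc n) _ (λ j → f (pk j) ≟ f (pk zero))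
           (middle-not-monochromatic mv fc≢fp fc'≢fp' (f (pk zero)))
  ... | j , fj≢f0 = j , zero , fj≢f0
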